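{- Let $\psi:\mathcal{B}_n\to\mathcal{B}_n$ be defined by $\psi(\pi)=\widetilde{\pi}$, where for $i\in[n]$, $\widetilde{\pi}_i=\pi_{n+1-i}-n-1$ if $\pi_{n+1-i}>0$ and $\widetilde{\pi}_i=\pi_{n+1-i}+n+1$ if $\pi_{n+1-i}<0$. Then $\psi$ is a bijection on $\mathcal{B}_n$ and $\mathrm{des}_B(\psi(\pi))=n-\mathrm{des}_B(\pi)$ for every $\pi\in\mathcal{B}_n$.
   Context: $\mathcal{B}_n$ is the group of signed permutations of $[n]=\{1,\dots,n\}$ (bijections $\pi$ of $\{\pm1,\dots,\pm n\}$ with $\pi(-i)=-\pi(i)$), written $\pi=\pi_1\cdots\pi_n$ with $\pi_i=\pi(i)$, and $\pi_0=0$; integers are compared in the usual order. $\mathrm{Des}_B(\pi)=\{i\in\{0,1,\dots,n-1\}:\pi_i>\pi_{i+1}\}$ and $\mathrm{des}_B(\pi)=|\mathrm{Des}_B(\pi)|$. -}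

module Defs where

open import Data.Nat as ℕ using (ℕ; zero; suc)
open import Data.Fin using (Fin; zero; suc; inject₁; opposite)
open import Data.Integer as ℤ using (ℤ; +_; _+_; _-_; ∣_∣; _<_; _<?_)
open import Data.List using (List; length; filter)
open import Data.Product using (_×_)
open import Data.Bool using (if_then_else_)
open import Relation.Nullary using (does)
open import Relation.Binary.PropositionalEquality using (_≡_)
open import Data.List using () renaming (allFin to allFinL)

-- A signed permutation of [n] in one-line notation: the word
-- π = π₁ ⋯ πₙ, given as a function Fin n → ℤ (position i : Fin n is the
-- paper's position toℕ i + 1).
Word : ℕ → Set
Word n = Fin n → ℤ

-- This is exactly the data of a bijection
-- of {±1,…,±n} commuting with negation.
IsSignedPerm : (n : ℕ) → Word n → Set
IsSignedPerm n w =
  (∀ i → (1 ℕ.≤ ∣ w i ∣) × (∣ w i ∣ ℕ.≤ n)) ×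
  (∀ i j → ∣ w i ∣ ≡ ∣ w j ∣ → i ≡ j)

-- Entry to the left of position i, with the convention π₀ = 0.
prev : {n : ℕ} → Word n → Fin n → ℤ
prev w zero    = + 0
prev w (suc j) = w (inject₁ j)

-- Des_B(π) = { i ∈ {0,…,n-1} : πᵢ > πᵢ₊₁ }, where position k : Fin n
-- stands for the paper's index i = toℕ k (comparing π_k with π_{k+1}).
DesB : (n : ℕ) → Word n → List (Fin n)
DesB n w = filter (λ k → w k <? prev w k) (allFinL n)

desB : (n : ℕ) → Word n → ℕ
desB n w = length (DesB n w)

-- ψ(π)ᵢ = π_{n+1-i} - n - 1 if π_{n+1-i} > 0, and π_{n+1-i} + n + 1 if
-- π_{n+1-i} < 0.  (opposite i = n-1-i, i.e. paper index n+1-i.)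
psi : (n : ℕ) → Word n → Word n
psi n w i =
  if does (+ 0 <? w (opposite i))
  then w (opposite i) - + (suc n)
  else w (opposite i) + + (suc n)

-- Write f for the entry map of ψ, so that ψ(π)ᵢ = f(π_{n+1-i}).  On
-- [1,n] and on [-n,-1] the map f is a translation, and it exchanges these
-- two blocks; hence f is an involution, ψ is an involution of B_n, and
-- for adjacent entries x = πⱼ, y = πⱼ₊₁ the corresponding pair f(y), f(x)
-- of ψ(π) satisfies
--   [f(x) < f(y)] + [y < x] + [y > 0] = [x > 0] + 1.
-- Summing over j telescopes the sign brackets, and the two descents at
-- position 0 (of π and of ψ(π)) supply the missing boundary terms, giving
-- des_B(ψ(π)) + des_B(π) = n.
module Submission where

open import Defs
open import Data.Nat as ℕ using (ℕ; zero; suc; _+_; _∸_; s≤s; z≤n)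
open import Data.Nat.Solver using (module +-*-Solver)
import Data.Nat.Properties as ℕ
open import Data.Fin using (Fin; zero; suc; inject₁; fromℕ; opposite)
import Data.Fin.Properties as Fin
open import Data.Fin.Permutation using (reverse)
open import Data.Integer as ℤ using (ℤ; +_; +[1+_]; -[1+_]; ∣_∣; _<_; _<?_; -_; +<+; -<+)
import Data.Integer.Properties as ℤ
open import Data.Bool using (Bool; true; false; if_then_else_)
open import Data.List using (length; filter; tabulate)
open import Data.Product using (_×_; Σ; _,_; proj₂)
open import Data.Sum using (_⊎_; inj₁; inj₂)
open import Data.Empty using (⊥-elim)
open import Function using (_∘_; id)
open import Relation.Nullary using (¬_; Dec; does)
open import Relation.Nullary.Decidable using (dec-true; dec-false)
open import Relation.Binary using (tri<; tri≈; tri>)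
open import Relation.Binary.PropositionalEquality
  using (_≡_; _≢_; refl; sym; trans; cong; cong₂; subst; module ≡-Reasoning)
open import Algebra.Properties.CommutativeMonoid.Sum ℕ.+-0-commutativeMonoid
  using (sum; sum-cong-≗; sum-permute; ∑-distrib-+)
open import Algebra.Bundles using (AbelianGroup)
open import Algebra.Properties.Group (AbelianGroup.group ℤ.+-0-abelianGroup)
  using (//-rightDividesˡ; //-rightDividesʳ)

open ≡-Reasoning


𝟙 : Bool → ℕ
𝟙 true  = 1
𝟙 false = 0

[_<_] : ℤ → ℤ → ℕ
[ x < y ] = 𝟙 (does (x <? y))

[<]≡1 : ∀ {x y} → x < y → [ x < y ] ≡ 1
[<]≡1 {x} {y} x<y rewrite dec-true (x <? y) x<y = refl

[<]≡0 : ∀ {x y} → ¬ x < y → [ x < y ] ≡ 0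
[<]≡0 {x} {y} x≮y rewrite dec-false (x <? y) x≮y = refl

[<]+[>]≡1 : ∀ {x y} → x ≢ y → [ x < y ] + [ y < x ] ≡ 1
[<]+[>]≡1 {x} {y} x≢y with ℤ.<-cmp x y
... | tri< x<y _ _ rewrite [<]≡1 x<y | [<]≡0 (ℤ.<-asym x<y) = refl
... | tri≈ _ x≡y _ = ⊥-elim (x≢y x≡y)
... | tri> _ _ y<x rewrite [<]≡0 (ℤ.<-asym y<x) | [<]≡1 y<x = refl

[<]-strictMono : (f : ℤ → ℤ) → (∀ {x y} → x < y → f x < f y) →
                 ∀ x y → [ f x < f y ] ≡ [ x < y ]
[<]-strictMono f mono x y with ℤ.<-cmp x y
... | tri< x<y _ _ = trans ([<]≡1 (mono x<y)) (sym ([<]≡1 x<y))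
... | tri≈ _ refl _ = trans ([<]≡0 {f x} (ℤ.<-irrefl refl)) (sym ([<]≡0 {x} (ℤ.<-irrefl refl)))
... | tri> _ _ y<x = trans ([<]≡0 (ℤ.<-asym (mono y<x))) (sym ([<]≡0 (ℤ.<-asym y<x)))


length-filter-tabulate : ∀ {A : Set} {P : A → Set} (P? : ∀ x → Dec (P x)) {n} (f : Fin n → A) →
  length (filter P? (tabulate f)) ≡ sum (λ i → 𝟙 (does (P? (f i))))
length-filter-tabulate P? {zero}  f = refl
length-filter-tabulate P? {suc n} f with does (P? (f zero))
... | true  = cong suc (length-filter-tabulate P? (f ∘ suc))
... | false = length-filter-tabulate P? (f ∘ suc)

∑-telescope : ∀ {m} (x : Fin m → ℕ) (g : Fin (suc m) → ℕ) →
              (∀ j → x j + g (suc j) ≡ g (inject₁ j) + 1) →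
              sum x + g (fromℕ m) ≡ g zero + m
∑-telescope {zero}  x g step = ℕ.+-comm 0 (g zero)
∑-telescope {suc m} x g step = begin
  x zero + sum (x ∘ suc) + g (fromℕ (suc m)) ≡⟨ ℕ.+-assoc (x zero) _ _ ⟩
  x zero + (sum (x ∘ suc) + g (fromℕ (suc m)))
    ≡⟨ cong (λ s → x zero + s) (∑-telescope (x ∘ suc) (g ∘ suc) (step ∘ suc)) ⟩
  x zero + (g (suc zero) + m)                   ≡⟨ ℕ.+-assoc (x zero) _ m ⟨
  x zero + g (suc zero) + m                     ≡⟨ cong (_+ m) (step zero) ⟩
  g zero + 1 + m                                ≡⟨ ℕ.+-assoc (g zero) 1 m ⟩
  g zero + suc m                                ∎


psiEntry : ℕ → ℤ → ℤ
psiEntry n x = if does (+ 0 <? x) then x ℤ.- + suc n else x ℤ.+ + suc n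

InRange : ℕ → ℤ → Set
InRange n x = (1 ℕ.≤ ∣ x ∣) × (∣ x ∣ ℕ.≤ n)

psiEntry-pos : ∀ n {x} → + 0 < x → psiEntry n x ≡ x ℤ.+ - + suc n
psiEntry-pos n {x} 0<x rewrite dec-true (+ 0 <? x) 0<x = refl

psiEntry-neg : ∀ n {x} → x < + 0 → psiEntry n x ≡ x ℤ.+ + suc n
psiEntry-neg n {x} x<0 rewrite dec-false (+ 0 <? x) (ℤ.<-asym x<0) = refl

psiEntry-+[1+] : ∀ {n k} → k ℕ.< n → psiEntry n +[1+ k ] ≡ - + (n ∸ k)
psiEntry-+[1+] {n} {k} k<n = begin
  psiEntry n +[1+ k ]         ≡⟨ psiEntry-pos n (+<+ (s≤s z≤n)) ⟩
  +[1+ k ] ℤ.+ - + suc n      ≡⟨ ℤ.m-n≡m⊖n (suc k) (suc n) ⟩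
  suc k ℤ.⊖ suc n             ≡⟨ ℤ.⊖-< (s≤s k<n) ⟩
  - + (n ∸ k)                 ∎

psiEntry--[1+] : ∀ {n k} → k ℕ.< n → psiEntry n -[1+ k ] ≡ + (n ∸ k)
psiEntry--[1+] {n} {k} k<n =
  trans (psiEntry-neg n { -[1+ k ]} -<+) (ℤ.⊖-≥ (s≤s (ℕ.<⇒≤ k<n)))

sign : ∀ {n} x → InRange n x → + 0 < x ⊎ x < + 0
sign +[1+ k ] _ = inj₁ (+<+ (s≤s z≤n))
sign -[1+ k ] _ = inj₂ -<+
sign (+ 0) (() , _)

psiEntry-abs : ∀ {n} x → InRange n x → ∣ psiEntry n x ∣ ≡ suc n ∸ ∣ x ∣
psiEntry-abs {n} +[1+ k ] (_ , k<n) = trans (cong ∣_∣ (psiEntry-+[1+] k<n)) (ℤ.∣-i∣≡∣i∣ (+ (n ∸ k)))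
psiEntry-abs {n} -[1+ k ] (_ , k<n) = cong ∣_∣ (psiEntry--[1+] k<n)

psiEntry-inRange : ∀ {n} x → InRange n x → InRange n (psiEntry n x)
psiEntry-inRange {n} x r@(1≤∣x∣ , ∣x∣≤n) =
  subst (1 ℕ.≤_) (sym (psiEntry-abs x r)) (ℕ.m<n⇒0<n∸m (s≤s ∣x∣≤n)) ,
  subst (ℕ._≤ n) (sym (psiEntry-abs x r)) (ℕ.∸-monoʳ-≤ (suc n) 1≤∣x∣)

psiEntry-pos⇒neg : ∀ {n} x → InRange n x → + 0 < x → psiEntry n x < + 0
psiEntry-pos⇒neg {n} +[1+ k ] (_ , k<n) _
  rewrite psiEntry-+[1+] k<n = ℤ.neg-mono-< (+<+ (ℕ.m<n⇒0<n∸m k<n))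
psiEntry-pos⇒neg -[1+ k ] _ ()
psiEntry-pos⇒neg (+ 0) (() , _) _

psiEntry-neg⇒pos : ∀ {n} x → InRange n x → x < + 0 → + 0 < psiEntry n x
psiEntry-neg⇒pos {n} -[1+ k ] (_ , k<n) _
  rewrite psiEntry--[1+] k<n = +<+ (ℕ.m<n⇒0<n∸m k<n)
psiEntry-neg⇒pos (+ _) _ (+<+ ())

psiEntry-involutive : ∀ {n} x → InRange n x → psiEntry n (psiEntry n x) ≡ x
psiEntry-involutive {n} x r with sign x r
... | inj₁ 0<x = begin
  psiEntry n (psiEntry n x)     ≡⟨ psiEntry-neg n (psiEntry-pos⇒neg x r 0<x) ⟩
  psiEntry n x ℤ.+ + suc n      ≡⟨ cong (ℤ._+ + suc n) (psiEntry-pos n 0<x) ⟩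
  x ℤ.+ - + suc n ℤ.+ + suc n   ≡⟨ //-rightDividesˡ (+ suc n) x ⟩
  x                             ∎
... | inj₂ x<0 = begin
  psiEntry n (psiEntry n x)     ≡⟨ psiEntry-pos n (psiEntry-neg⇒pos x r x<0) ⟩
  psiEntry n x ℤ.+ - + suc n    ≡⟨ cong (ℤ._+ - + suc n) (psiEntry-neg n x<0) ⟩
  x ℤ.+ + suc n ℤ.+ - + suc n   ≡⟨ //-rightDividesʳ (+ suc n) x ⟩
  x                             ∎

[psiEntry<0]≡[0<] : ∀ {n} x → InRange n x → [ psiEntry n x < + 0 ] ≡ [ + 0 < x ]
[psiEntry<0]≡[0<] x r with sign x r
... | inj₁ 0<x = trans ([<]≡1 (psiEntry-pos⇒neg x r 0<x)) (sym ([<]≡1 0<x))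
... | inj₂ x<0 = trans ([<]≡0 (ℤ.<-asym (psiEntry-neg⇒pos x r x<0))) (sym ([<]≡0 (ℤ.<-asym x<0)))

[<]-translate : ∀ c x y → [ x ℤ.+ c < y ℤ.+ c ] ≡ [ x < y ]
[<]-translate c = [<]-strictMono (ℤ._+ c) (ℤ.+-monoˡ-< c)

descent-complement : ∀ {n} x y → InRange n x → InRange n y → x ≢ y →
  [ psiEntry n x < psiEntry n y ] + [ y < x ] + [ + 0 < y ] ≡ [ + 0 < x ] + 1
descent-complement {n} x y rx ry x≢y = bySigns (sign x rx) (sign y ry)
  where
  goal : Set
  goal = [ psiEntry n x < psiEntry n y ] + [ y < x ] + [ + 0 < y ] ≡ [ + 0 < x ] + 1

  sameSign : ∀ c {s} → psiEntry n x ≡ x ℤ.+ c → psiEntry n y ≡ y ℤ.+ c →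
             [ + 0 < x ] ≡ s → [ + 0 < y ] ≡ s → goal
  sameSign c {s} ψx ψy sx sy = begin
    [ psiEntry n x < psiEntry n y ] + [ y < x ] + [ + 0 < y ]
      ≡⟨ cong₂ (λ a b → a + [ y < x ] + b) (trans (cong₂ [_<_] ψx ψy) ([<]-translate c x y)) sy ⟩
    [ x < y ] + [ y < x ] + s ≡⟨ cong (λ a → a + s) ([<]+[>]≡1 x≢y) ⟩
    1 + s                     ≡⟨ ℕ.+-comm 1 s ⟩
    s + 1                     ≡⟨ cong (λ a → a + 1) sx ⟨
    [ + 0 < x ] + 1           ∎

  bySigns : + 0 < x ⊎ x < + 0 → + 0 < y ⊎ y < + 0 → goal
  bySigns (inj₁ 0<x) (inj₁ 0<y) =
    sameSign (- + suc n) (psiEntry-pos n 0<x) (psiEntry-pos n 0<y) ([<]≡1 0<x) ([<]≡1 0<y)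
  bySigns (inj₂ x<0) (inj₂ y<0) =
    sameSign (+ suc n) (psiEntry-neg n x<0) (psiEntry-neg n y<0)
             ([<]≡0 (ℤ.<-asym x<0)) ([<]≡0 (ℤ.<-asym y<0))
  bySigns (inj₁ 0<x) (inj₂ y<0)
    rewrite [<]≡1 (ℤ.<-trans (psiEntry-pos⇒neg x rx 0<x) (psiEntry-neg⇒pos y ry y<0))
          | [<]≡1 (ℤ.<-trans y<0 0<x) | [<]≡0 (ℤ.<-asym y<0) | [<]≡1 0<x = refl
  bySigns (inj₂ x<0) (inj₁ 0<y)
    rewrite [<]≡0 (ℤ.<-asym (ℤ.<-trans (psiEntry-pos⇒neg y ry 0<y) (psiEntry-neg⇒pos x rx x<0)))
          | [<]≡0 (ℤ.<-asym (ℤ.<-trans x<0 0<y)) | [<]≡1 0<y | [<]≡0 (ℤ.<-asym x<0) = refl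


inRange⇒0≢ : ∀ {n} x → InRange n x → + 0 ≢ x
inRange⇒0≢ (+ 0)      (() , _)
inRange⇒0≢ +[1+ _ ] _ ()
inRange⇒0≢ -[1+ _ ] _ ()

adjacent-distinct : ∀ {m} (w : Word (suc m)) → IsSignedPerm (suc m) w →
                    ∀ (j : Fin m) → w (inject₁ j) ≢ w (suc j)
adjacent-distinct w (_ , injective) j eq =
  Fin.<⇒≢ (Fin.≤̄⇒inject₁< Fin.≤-refl) (injective (inject₁ j) (suc j) (cong ∣_∣ eq))

opposite-inject₁ : ∀ {n} (j : Fin n) → opposite (inject₁ j) ≡ suc (opposite j)
opposite-inject₁ {suc n} zero    = refl
opposite-inject₁ {suc n} (suc j) = cong inject₁ (opposite-inject₁ j)

opposite-injective : ∀ {n} {i j : Fin n} → opposite i ≡ opposite j → i ≡ j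
opposite-injective {i = i} {j} eq =
  trans (sym (Fin.opposite-involutive i)) (trans (cong opposite eq) (Fin.opposite-involutive j))

psi-isSignedPerm : ∀ n (w : Word n) → IsSignedPerm n w → IsSignedPerm n (psi n w)
psi-isSignedPerm n w (inRange , injective) =
  (λ i → psiEntry-inRange (w (opposite i)) (inRange (opposite i))) , ∣psi∣-injective
  where
  ∣psi∣-injective : ∀ i j → ∣ psi n w i ∣ ≡ ∣ psi n w j ∣ → i ≡ j
  ∣psi∣-injective i j eq = opposite-injective (injective (opposite i) (opposite j)
    (ℕ.∸-cancelˡ-≡ (ℕ.m≤n⇒m≤1+n (proj₂ (inRange (opposite i))))
                   (ℕ.m≤n⇒m≤1+n (proj₂ (inRange (opposite j))))
      (begin
        suc n ∸ ∣ w (opposite i) ∣ ≡⟨ psiEntry-abs (w (opposite i)) (inRange (opposite i)) ⟨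
        ∣ psi n w i ∣             ≡⟨ eq ⟩
        ∣ psi n w j ∣             ≡⟨ psiEntry-abs (w (opposite j)) (inRange (opposite j)) ⟩
        suc n ∸ ∣ w (opposite j) ∣ ∎)))

psi-involutive : ∀ n (w : Word n) → IsSignedPerm n w → ∀ i → psi n (psi n w) i ≡ w i
psi-involutive n w (inRange , _) i = begin
  psiEntry n (psiEntry n (w (opposite (opposite i))))
    ≡⟨ cong (λ k → psiEntry n (psiEntry n (w k))) (Fin.opposite-involutive i) ⟩
  psiEntry n (psiEntry n (w i))
    ≡⟨ psiEntry-involutive (w i) (inRange i) ⟩
  w i ∎

desB-suc : ∀ m (w : Word (suc m)) →
           desB (suc m) w ≡ [ w zero < + 0 ] + sum (λ j → [ w (suc j) < w (inject₁ j) ])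
desB-suc m w = length-filter-tabulate (λ k → w k <? prev w k) id

desB-psi-suc : ∀ m (w : Word (suc m)) → InRange (suc m) (w (fromℕ m)) →
  desB (suc m) (psi (suc m) w) ≡
  [ + 0 < w (fromℕ m) ] + sum (λ j → [ psiEntry (suc m) (w (inject₁ j)) < psiEntry (suc m) (w (suc j)) ])
desB-psi-suc m w r = begin
  desB (suc m) (psi (suc m) w)
    ≡⟨ desB-suc m (psi (suc m) w) ⟩
  [ f (w (fromℕ m)) < + 0 ] + sum (λ j → [ f (w (inject₁ (opposite j))) < f (w (opposite (inject₁ j))) ])
    ≡⟨ cong₂ _+_ ([psiEntry<0]≡[0<] (w (fromℕ m)) r)
                 (sum-cong-≗ (λ j → cong (λ k → [ f (w (inject₁ (opposite j))) < f (w k) ]) (opposite-inject₁ j))) ⟩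
  [ + 0 < w (fromℕ m) ] + sum (ascents ∘ opposite)
    ≡⟨ cong (λ s → [ + 0 < w (fromℕ m) ] + s) (sum-permute ascents reverse) ⟨
  [ + 0 < w (fromℕ m) ] + sum ascents ∎
  where
  f : ℤ → ℤ
  f = psiEntry (suc m)
  ascents : Fin m → ℕ
  ascents j = [ f (w (inject₁ j)) < f (w (suc j)) ]

desB-psi-+-desB : ∀ n (w : Word n) → IsSignedPerm n w → desB n (psi n w) + desB n w ≡ n
desB-psi-+-desB zero    w _ = refl
desB-psi-+-desB (suc m) w σ@(inRange , _) = begin
  desB (suc m) (psi (suc m) w) + desB (suc m) w
    ≡⟨ cong₂ _+_ (desB-psi-suc m w (inRange (fromℕ m))) (desB-suc m w) ⟩
  (pos (fromℕ m) + sum ascentsψ) + ([ w zero < + 0 ] + sum descents)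
    ≡⟨ solve 4 (λ p a e d → (p :+ a) :+ (e :+ d) := (a :+ d :+ p) :+ e) refl
               (pos (fromℕ m)) (sum ascentsψ) [ w zero < + 0 ] (sum descents) ⟩
  (sum ascentsψ + sum descents + pos (fromℕ m)) + [ w zero < + 0 ]
    ≡⟨ cong (λ s → s + pos (fromℕ m) + [ w zero < + 0 ]) (∑-distrib-+ ascentsψ descents) ⟨
  (sum (λ j → ascentsψ j + descents j) + pos (fromℕ m)) + [ w zero < + 0 ]
    ≡⟨ cong (λ s → s + [ w zero < + 0 ]) (∑-telescope _ pos step) ⟩
  pos zero + m + [ w zero < + 0 ]
    ≡⟨ solve 3 (λ p m e → p :+ m :+ e := m :+ (p :+ e)) refl (pos zero) m [ w zero < + 0 ] ⟩
  m + (pos zero + [ w zero < + 0 ])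
    ≡⟨ cong (λ s → m + s) ([<]+[>]≡1 (inRange⇒0≢ (w zero) (inRange zero))) ⟩
  m + 1
    ≡⟨ ℕ.+-comm m 1 ⟩
  suc m ∎
  where
  open +-*-Solver
  pos : Fin (suc m) → ℕ
  pos k = [ + 0 < w k ]
  ascentsψ descents : Fin m → ℕ
  ascentsψ j = [ psiEntry (suc m) (w (inject₁ j)) < psiEntry (suc m) (w (suc j)) ]
  descents j = [ w (suc j) < w (inject₁ j) ]
  step : ∀ j → ascentsψ j + descents j + pos (suc j) ≡ pos (inject₁ j) + 1
  step j = descent-complement (w (inject₁ j)) (w (suc j)) (inRange (inject₁ j)) (inRange (suc j))
                              (adjacent-distinct w σ j)

psi-injective : ∀ n (v w : Word n) → IsSignedPerm n v → IsSignedPerm n w →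
                (∀ i → psi n v i ≡ psi n w i) → ∀ i → v i ≡ w i
psi-injective n v w σ τ eq i = begin
  v i                               ≡⟨ psi-involutive n v σ i ⟨
  psiEntry n (psi n v (opposite i)) ≡⟨ cong (psiEntry n) (eq (opposite i)) ⟩
  psiEntry n (psi n w (opposite i)) ≡⟨ psi-involutive n w τ i ⟩
  w i                               ∎

desB-psi≡n∸desB : ∀ n (w : Word n) → IsSignedPerm n w → desB n (psi n w) ≡ n ∸ desB n w
desB-psi≡n∸desB n w σ = begin
  desB n (psi n w)                       ≡⟨ ℕ.m+n∸n≡m (desB n (psi n w)) (desB n w) ⟨
  desB n (psi n w) + desB n w ∸ desB n w ≡⟨ cong (_∸ desB n w) (desB-psi-+-desB n w σ) ⟩
  n ∸ desB n w                           ∎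

lemma2p1 : (n : ℕ) →
    ((w : Word n) → IsSignedPerm n w → IsSignedPerm n (psi n w)) ×
    ((v w : Word n) → IsSignedPerm n v → IsSignedPerm n w →
       (∀ i → psi n v i ≡ psi n w i) → ∀ i → v i ≡ w i) ×
    ((w : Word n) → IsSignedPerm n w →
       Σ (Word n) (λ v → IsSignedPerm n v × (∀ i → psi n v i ≡ w i))) ×
    ((w : Word n) → IsSignedPerm n w → desB n (psi n w) ≡ n ∸ desB n w)
lemma2p1 n =
  psi-isSignedPerm n ,
  psi-injective n ,
  (λ w σ → psi n w , psi-isSignedPerm n w σ , psi-involutive n w σ) ,
  desB-psi≡n∸desB n
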